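{- A connected chordal graph is $2$-connected if and only if it is locally connected.
   Context: All graphs are finite, simple and undirected. A graph is chordal if it has no induced cycle of length $4$ or more. A graph $G$ is locally connected if for every vertex $v$, the neighbourhood $N(v)$ induces a connected subgraph of $G$. -}

module Defs where

open import Data.Nat using (ℕ; suc; _+_; _%_)
open import Data.Fin using (Fin; toℕ)
open import Data.Product using (Σ; _×_; ∃-syntax)
open import Data.Sum using (_⊎_)
open import Data.Unit using (⊤)
open import Data.Empty using (⊥)
open import Relation.Nullary using (¬_; Dec)
open import Relation.Binary.PropositionalEquality using (_≡_; _≢_)
open import Function.Bundles using (_⇔_)
open import Function.Definitions using (Injective)

record Graph (n : ℕ) : Set₁ where
  field
    Adj   : Fin n → Fin n → Set
    dec   : ∀ u v → Dec (Adj u v)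
    sym   : ∀ {u v} → Adj u v → Adj v u
    irrefl : ∀ {u} → ¬ Adj u u
open Graph public

module _ {n : ℕ} (G : Graph n) where

  data WalkIn (S : Fin n → Set) : Fin n → Fin n → Set where
    [_]  : ∀ {u} → S u → WalkIn S u u
    _∷_  : ∀ {u w v} → (S u × Adj G u w) → WalkIn S w v → WalkIn S u v

  InducedConnected : (Fin n → Set) → Set
  InducedConnected S =
    (∃[ v ] S v) × (∀ u v → S u → S v → WalkIn S u v)

  Connected : Set
  Connected = InducedConnected (λ _ → ⊤)

  TwoConnected : Set
  TwoConnected = Connected × (∀ v → InducedConnected (λ u → u ≢ v))

  N : Fin n → Fin n → Set
  N v u = Adj G v u

  LocallyConnected : Set
  LocallyConnected = ∀ v → InducedConnected (N v)

  CycConsec : (m : ℕ) → Fin (4 + m) → Fin (4 + m) → Set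
  CycConsec m i j =
    (suc (toℕ i) % (4 + m) ≡ toℕ j) ⊎ (suc (toℕ j) % (4 + m) ≡ toℕ i)

  InducedCycle : (m : ℕ) → (Fin (4 + m) → Fin n) → Set
  InducedCycle m c =
    Injective _≡_ _≡_ c × (∀ i j → Adj G (c i) (c j) ⇔ CycConsec m i j)

  Chordal : Set
  Chordal = ∀ m (c : Fin (4 + m) → Fin n) → ¬ InducedCycle m c

module Submission where

-- (⇐) Holds for every connected graph: a walk between two vertices of G - v
-- that passes through v enters and leaves v through two neighbours of v,
-- and these are joined by a walk inside N(v), which avoids v.
--
-- (⇒) Let x, y be neighbours of v and w a walk from x to y in G - v.  By
-- well-founded recursion on the length of w we produce a walk from x to y
-- inside N(v).  If some interior vertex of w lies in N(v) we split w there;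
-- if w revisits a vertex or has a chord we shortcut it.  Otherwise w is an
-- induced path of length ≥ 2 whose ends, and only its ends, are adjacent to
-- v, so v together with w is an induced cycle of length ≥ 4, contradicting
-- chordality.

open import Defs
open import Data.Nat using (ℕ; zero; suc; _+_; _∸_; _≤_; _<_; _%_; _<?_; NonZero; z≤n; s≤s; z<s)
open import Data.Nat.Properties
open import Data.Nat.DivMod using (m<n⇒m%n≡m; n%n≡0)
open import Data.Nat.Induction using (<-wellFounded)
open import Induction.WellFounded using (Acc; acc)
open import Data.Fin using (Fin; toℕ)
open import Data.Fin.Properties using (toℕ-injective; toℕ<n) renaming (_≟_ to _≟ᶠ_)
open import Data.Product using (_×_; _,_; proj₁; proj₂; ∃-syntax; Σ-syntax)
open import Data.Sum using (_⊎_; inj₁; inj₂; swap)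
open import Data.Sum.Function.Propositional using (_⊎-⇔_)
open import Data.Unit using (⊤; tt)
open import Data.Empty using (⊥-elim)
open import Relation.Nullary using (¬_; Dec; yes; no)
open import Relation.Nullary.Decidable using (_×-dec_; _⊎-dec_)
open import Relation.Binary.Definitions using (tri<; tri≈; tri>)
open import Relation.Binary.PropositionalEquality
  using (_≡_; _≢_; ≢-sym; refl; cong; subst) renaming (sym to ≡-sym; trans to ≡-trans)
open import Function.Bundles using (_⇔_; mk⇔)
open import Function.Properties.Equivalence using () renaming (sym to ⇔-sym; trans to ⇔-trans)

Next : ℕ → ℕ → ℕ → Set
Next N a b = suc a ≡ b ⊎ (b ≡ 0 × suc a ≡ N)

next⇔mod : ∀ {N a b} .{{_ : NonZero N}} → a < N → b < N → (suc a % N ≡ b) ⇔ Next N a b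
next⇔mod {N} {a} {b} a<N b<N = mk⇔ to from
  where
  wrap : suc a ≡ N → suc a % N ≡ 0
  wrap eq = subst (λ z → z % N ≡ 0) (≡-sym eq) (n%n≡0 N)

  to : suc a % N ≡ b → Next N a b
  to e with m≤n⇒m<n∨m≡n a<N
  ... | inj₁ sa<N = inj₁ (≡-trans (≡-sym (m<n⇒m%n≡m sa<N)) e)
  ... | inj₂ sa≡N = inj₂ (≡-trans (≡-sym e) (wrap sa≡N) , sa≡N)

  from : Next N a b → suc a % N ≡ b
  from (inj₁ refl) = m<n⇒m%n≡m b<N
  from (inj₂ (refl , sa≡N)) = wrap sa≡N

_◂_ : ∀ {n} → Fin n → (ℕ → Fin n) → ℕ → Fin n
(x ◂ p) zero = x
(x ◂ p) (suc i) = p i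

module _ {n : ℕ} (G : Graph n) where

  adj-comm : ∀ {a b} → Adj G a b ⇔ Adj G b a
  adj-comm = mk⇔ (sym G) (sym G)

  neighbour≢ : ∀ {v u} → Adj G v u → u ≢ v
  neighbour≢ e refl = irrefl G e

  weaken : ∀ {S T : Fin n → Set} → (∀ {u} → S u → T u) → ∀ {a b} → WalkIn G S a b → WalkIn G T a b
  weaken f [ s ] = [ f s ]
  weaken f ((s , e) ∷ w) = (f s , e) ∷ weaken f w

  infixr 5 _++ʷ_
  _++ʷ_ : ∀ {S a b c} → WalkIn G S a b → WalkIn G S b c → WalkIn G S a c
  [ _ ] ++ʷ w' = w'
  (e ∷ w) ++ʷ w' = e ∷ (w ++ʷ w')

  length : ∀ {S a b} → WalkIn G S a b → ℕ
  length [ _ ] = 0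
  length (_ ∷ w) = suc (length w)

  length-++ : ∀ {S a b c} (w : WalkIn G S a b) (w' : WalkIn G S b c) → length (w ++ʷ w') ≡ length w + length w'
  length-++ [ _ ] w' = refl
  length-++ (_ ∷ w) w' = cong suc (length-++ w w')

  join : ∀ {S a b c d} → WalkIn G S a b → b ≡ c → WalkIn G S c d → WalkIn G S a d
  join w refl w' = w ++ʷ w'

  length-join : ∀ {S a b c d} (w : WalkIn G S a b) (e : b ≡ c) (w' : WalkIn G S c d) →
                length (join w e w') ≡ length w + length w'
  length-join w refl w' = length-++ w w'

  first-edge : ∀ {S a b} → a ≢ b → WalkIn G S a b → ∃[ u ] Adj G a u
  first-edge a≢b [ _ ] = ⊥-elim (a≢b refl)
  first-edge _ ((_ , e) ∷ _) = _ , e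

  -- The vertex at position i of a walk (its last vertex beyond its length).
  vertex : ∀ {S a b} → WalkIn G S a b → ℕ → Fin n
  vertex {a = a} [ _ ] _ = a
  vertex {a = a} (_ ∷ _) zero = a
  vertex (_ ∷ w) (suc i) = vertex w i

  vertex-first : ∀ {S a b} (w : WalkIn G S a b) → vertex w 0 ≡ a
  vertex-first [ _ ] = refl
  vertex-first (_ ∷ _) = refl

  vertex-last : ∀ {S a b} (w : WalkIn G S a b) → vertex w (length w) ≡ b
  vertex-last [ _ ] = refl
  vertex-last (_ ∷ w) = vertex-last w

  vertex-in : ∀ {S a b} (w : WalkIn G S a b) i → S (vertex w i)
  vertex-in [ s ] _ = s
  vertex-in ((s , _) ∷ _) zero = s
  vertex-in (_ ∷ w) (suc i) = vertex-in w i

  vertex-adj : ∀ {S a b} (w : WalkIn G S a b) i → i < length w → Adj G (vertex w i) (vertex w (suc i))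
  vertex-adj ((_ , e) ∷ w) zero _ = subst (Adj G _) (≡-sym (vertex-first w)) e
  vertex-adj (_ ∷ w) (suc i) (s≤s i<k) = vertex-adj w i i<k

  take : ∀ {S a b} (w : WalkIn G S a b) i → WalkIn G S a (vertex w i)
  take [ s ] _ = [ s ]
  take ((s , _) ∷ _) zero = [ s ]
  take (e ∷ w) (suc i) = e ∷ take w i

  drop : ∀ {S a b} (w : WalkIn G S a b) i → WalkIn G S (vertex w i) b
  drop [ s ] _ = [ s ]
  drop (e ∷ w) zero = e ∷ w
  drop (_ ∷ w) (suc i) = drop w i

  length-take : ∀ {S a b} (w : WalkIn G S a b) i → length (take w i) ≤ i
  length-take [ _ ] _ = z≤n
  length-take (_ ∷ _) zero = z≤n
  length-take (_ ∷ w) (suc i) = s≤s (length-take w i)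

  length-drop : ∀ {S a b} (w : WalkIn G S a b) i → length (drop w i) ≡ length w ∸ i
  length-drop [ _ ] i = ≡-sym (0∸n≡0 i)
  length-drop (_ ∷ _) zero = refl
  length-drop (_ ∷ w) (suc i) = length-drop w i

  cut-shorter : ∀ {i j k} → i < j → j ≤ k → i + (k ∸ j) < k
  cut-shorter {i} {j} {k} i<j j≤k =
    subst (i + (k ∸ j) <_) (m+[n∸m]≡n j≤k) (+-monoˡ-< (k ∸ j) i<j)

  Shortcut : ∀ {S a b} → WalkIn G S a b → ℕ → ℕ → Set
  Shortcut w i j = vertex w i ≡ vertex w j ⊎ (suc i < j × Adj G (vertex w i) (vertex w j))

  HasShortcut : ∀ {S a b} → WalkIn G S a b → Set
  HasShortcut w = ∃[ j ] j < suc (length w) × ∃[ i ] i < j × Shortcut w i j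

  hasShortcut? : ∀ {S a b} (w : WalkIn G S a b) → Dec (HasShortcut w)
  hasShortcut? w = anyUpTo? (λ j → anyUpTo? (shortcut? j) j) (suc (length w))
    where
    shortcut? : ∀ j i → Dec (Shortcut w i j)
    shortcut? j i = (vertex w i ≟ᶠ vertex w j) ⊎-dec ((suc i <? j) ×-dec dec G (vertex w i) (vertex w j))

  shorten : ∀ {S a b} (w : WalkIn G S a b) → HasShortcut w → Σ[ w' ∈ WalkIn G S a b ] length w' < length w
  shorten w (j , s≤s j≤k , i , i<j , inj₁ same) =
    join (take w i) same (drop w j) ,
    (begin-strict
      length (join (take w i) same (drop w j)) ≡⟨ length-join (take w i) same (drop w j) ⟩
      length (take w i) + length (drop w j)    ≤⟨ +-mono-≤ (length-take w i) (≤-reflexive (length-drop w j)) ⟩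
      i + (length w ∸ j)                       <⟨ cut-shorter i<j j≤k ⟩
      length w                                 ∎)
    where open ≤-Reasoning
  shorten w (j , s≤s j≤k , i , _ , inj₂ (i+1<j , chord)) =
    take w i ++ʷ ((vertex-in w i , chord) ∷ drop w j) ,
    (begin-strict
      length (take w i ++ʷ (_ ∷ drop w j))        ≡⟨ length-++ (take w i) (_ ∷ drop w j) ⟩
      length (take w i) + suc (length (drop w j)) ≤⟨ +-mono-≤ (length-take w i) (s≤s (≤-reflexive (length-drop w j))) ⟩
      i + suc (length w ∸ j)                      ≡⟨ +-suc i (length w ∸ j) ⟩
      suc i + (length w ∸ j)                      <⟨ cut-shorter i+1<j j≤k ⟩
      length w                                    ∎)
    where open ≤-Reasoning

  record InducedPath (k : ℕ) (p : ℕ → Fin n) : Set where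
    field
      distinct : ∀ {i j} → i ≤ k → j ≤ k → p i ≡ p j → i ≡ j
      adjacent : ∀ {i j} → i ≤ k → j ≤ k → Adj G (p i) (p j) ⇔ (suc i ≡ j ⊎ suc j ≡ i)

  shortcut-free-induced : ∀ {S a b} (w : WalkIn G S a b) → ¬ HasShortcut w →
                          InducedPath (length w) (vertex w)
  shortcut-free-induced w noShortcut = record
    { distinct = distinct
    ; adjacent = λ i≤k j≤k → mk⇔ (to i≤k j≤k) (from i≤k j≤k)
    }
    where
    distinct : ∀ {i j} → i ≤ length w → j ≤ length w → vertex w i ≡ vertex w j → i ≡ j
    distinct {i} {j} i≤k j≤k same with <-cmp i j
    ... | tri< i<j _ _ = ⊥-elim (noShortcut (j , s≤s j≤k , i , i<j , inj₁ same))
    ... | tri≈ _ i≡j _ = i≡j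
    ... | tri> _ _ j<i = ⊥-elim (noShortcut (i , s≤s i≤k , j , j<i , inj₁ (≡-sym same)))

    consecutive : ∀ {i j} → i < j → j ≤ length w → Adj G (vertex w i) (vertex w j) → suc i ≡ j
    consecutive {i} {j} i<j j≤k e with m≤n⇒m<n∨m≡n i<j
    ... | inj₁ i+1<j = ⊥-elim (noShortcut (j , s≤s j≤k , i , i<j , inj₂ (i+1<j , e)))
    ... | inj₂ i+1≡j = i+1≡j

    to : ∀ {i j} → i ≤ length w → j ≤ length w → Adj G (vertex w i) (vertex w j) →
         suc i ≡ j ⊎ suc j ≡ i
    to {i} {j} i≤k j≤k e with <-cmp i j
    ... | tri< i<j _ _ = inj₁ (consecutive i<j j≤k e)
    ... | tri≈ _ refl _ = ⊥-elim (irrefl G e)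
    ... | tri> _ _ j<i = inj₂ (consecutive j<i i≤k (sym G e))

    from : ∀ {i j} → i ≤ length w → j ≤ length w → suc i ≡ j ⊎ suc j ≡ i →
           Adj G (vertex w i) (vertex w j)
    from _ j≤k (inj₁ refl) = vertex-adj w _ j≤k
    from i≤k _ (inj₂ refl) = sym G (vertex-adj w _ i≤k)

  apex-cycle : ∀ {m} (v : Fin n) {p : ℕ → Fin n} → InducedPath (2 + m) p →
               (∀ i → i ≤ 2 + m → p i ≢ v) →
               (∀ {i} → i ≤ 2 + m → Adj G v (p i) ⇔ (i ≡ 0 ⊎ i ≡ 2 + m)) →
               InducedCycle G m (λ a → (v ◂ p) (toℕ a))
  apex-cycle {m} v {p} path outside apex =
    (λ {a} {b} same → toℕ-injective (distinct (bound a) (bound b) same)) ,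
    λ a b → ⇔-trans (adjacent (bound a) (bound b)) (⇔-sym (cycConsec⇔ a b))
    where
    k : ℕ
    k = 2 + m
    c : ℕ → Fin n
    c = v ◂ p
    Consec : ℕ → ℕ → Set
    Consec a b = Next (2 + k) a b ⊎ Next (2 + k) b a

    bound : (a : Fin (4 + m)) → toℕ a ≤ suc k
    bound a = ≤-pred (toℕ<n a)

    cycConsec⇔ : ∀ a b → CycConsec G m a b ⇔ Consec (toℕ a) (toℕ b)
    cycConsec⇔ a b = next⇔mod (toℕ<n a) (toℕ<n b) ⊎-⇔ next⇔mod (toℕ<n b) (toℕ<n a)

    distinct : ∀ {a b} → a ≤ suc k → b ≤ suc k → c a ≡ c b → a ≡ b
    distinct {zero} {zero} _ _ _ = refl
    distinct {zero} {suc t} _ (s≤s t≤k) same = ⊥-elim (outside t t≤k (≡-sym same))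
    distinct {suc s} {zero} (s≤s s≤k) _ same = ⊥-elim (outside s s≤k same)
    distinct {suc s} {suc t} (s≤s s≤k) (s≤s t≤k) same = cong suc (InducedPath.distinct path s≤k t≤k same)

    apex-positions : ∀ {t} → (t ≡ 0 ⊎ t ≡ k) ⇔ Consec 0 (suc t)
    apex-positions = mk⇔ to from
      where
      to : ∀ {t} → t ≡ 0 ⊎ t ≡ k → Consec 0 (suc t)
      to (inj₁ refl) = inj₁ (inj₁ refl)
      to (inj₂ refl) = inj₂ (inj₂ (refl , refl))
      from : ∀ {t} → Consec 0 (suc t) → t ≡ 0 ⊎ t ≡ k
      from (inj₁ (inj₁ refl)) = inj₁ refl
      from (inj₂ (inj₂ (_ , t+2≡k+2))) = inj₂ (suc-injective (suc-injective t+2≡k+2))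

    path-positions : ∀ {s t} → (suc s ≡ t ⊎ suc t ≡ s) ⇔ Consec (suc s) (suc t)
    path-positions = mk⇔ to from
      where
      to : ∀ {s t} → suc s ≡ t ⊎ suc t ≡ s → Consec (suc s) (suc t)
      to (inj₁ refl) = inj₁ (inj₁ refl)
      to (inj₂ refl) = inj₂ (inj₁ refl)
      from : ∀ {s t} → Consec (suc s) (suc t) → suc s ≡ t ⊎ suc t ≡ s
      from (inj₁ (inj₁ e)) = inj₁ (suc-injective e)
      from (inj₂ (inj₁ e)) = inj₂ (suc-injective e)

    apex-adjacent : ∀ {t} → t ≤ k → Adj G v (p t) ⇔ Consec 0 (suc t)
    apex-adjacent t≤k = ⇔-trans (apex t≤k) apex-positions

    adjacent : ∀ {a b} → a ≤ suc k → b ≤ suc k → Adj G (c a) (c b) ⇔ Consec a b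
    adjacent {zero} {zero} _ _ = mk⇔ (λ e → ⊥-elim (irrefl G e)) λ where
      (inj₁ (inj₂ (_ , ()))) ; (inj₂ (inj₂ (_ , ())))
    adjacent {zero} {suc t} _ (s≤s t≤k) = apex-adjacent t≤k
    adjacent {suc s} {zero} (s≤s s≤k) _ =
      ⇔-trans adj-comm (⇔-trans (apex-adjacent s≤k) (mk⇔ swap swap))
    adjacent {suc s} {suc t} (s≤s s≤k) (s≤s t≤k) =
      ⇔-trans (InducedPath.adjacent path s≤k t≤k) path-positions

  module _ (locallyConnected : LocallyConnected G) (v : Fin n) where

    -- Every walk between vertices other than v can be rerouted to avoid v:
    -- a visit u → v → u' is replaced by a walk from u to u' inside N(v).
    avoid : ∀ {a b} → WalkIn G (λ _ → ⊤) a b → a ≢ v → b ≢ v → WalkIn G (_≢ v) a b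
    avoid [ _ ] a≢v _ = [ a≢v ]
    avoid (_∷_ {w = m} (_ , a~m) w) a≢v b≢v with m ≟ᶠ v
    ... | no m≢v = (a≢v , a~m) ∷ avoid w m≢v b≢v
    avoid (_ ∷ [ _ ]) _ b≢v | yes refl = ⊥-elim (b≢v refl)
    avoid ((_ , a~v) ∷ ((_ , v~m') ∷ w)) _ b≢v | yes refl =
      weaken neighbour≢ (proj₂ (locallyConnected v) _ _ (sym G a~v) v~m')
      ++ʷ avoid w (neighbour≢ v~m') b≢v

  -- Local connectivity of a connected graph yields 2-connectivity: G - v is
  -- non-empty since v has a neighbour, and connected by rerouting walks.
  locally⇒two-connected : Connected G → LocallyConnected G → TwoConnected G
  locally⇒two-connected connected locallyConnected = connected , λ v →
    let (u , v~u) = proj₁ (locallyConnected v)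
    in (u , neighbour≢ v~u) ,
       λ a b a≢v b≢v → avoid locallyConnected v (proj₂ connected a b tt tt) a≢v b≢v

  module _ (v : Fin n) where

    HasInteriorNeighbour : ∀ {a b} → WalkIn G (_≢ v) a b → Set
    HasInteriorNeighbour w = ∃[ i ] i < length w × (0 < i × Adj G v (vertex w i))

    hasInteriorNeighbour? : ∀ {a b} (w : WalkIn G (_≢ v) a b) → Dec (HasInteriorNeighbour w)
    hasInteriorNeighbour? w = anyUpTo? (λ i → (0 <? i) ×-dec dec G v (vertex w i)) (length w)

    apex-of : ∀ {a b} (w : WalkIn G (_≢ v) a b) → Adj G v a → Adj G v b → ¬ HasInteriorNeighbour w →
              ∀ {i} → i ≤ length w → Adj G v (vertex w i) ⇔ (i ≡ 0 ⊎ i ≡ length w)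
    apex-of w v~a v~b noInterior {i} i≤k = mk⇔ (to i i≤k) from
      where
      to : ∀ i → i ≤ length w → Adj G v (vertex w i) → i ≡ 0 ⊎ i ≡ length w
      to zero _ _ = inj₁ refl
      to (suc i) i+1≤k e with suc i ≟ length w
      ... | yes i+1≡k = inj₂ i+1≡k
      ... | no i+1≢k = ⊥-elim (noInterior (suc i , ≤∧≢⇒< i+1≤k i+1≢k , z<s , e))
      from : i ≡ 0 ⊎ i ≡ length w → Adj G v (vertex w i)
      from (inj₁ refl) = subst (Adj G v) (≡-sym (vertex-first w)) v~a
      from (inj₂ refl) = subst (Adj G v) (≡-sym (vertex-last w)) v~b

    neighbour-walk : Chordal G → ∀ {x y} (w : WalkIn G (_≢ v) x y) → Acc _<_ (length w) →
                     Adj G v x → Adj G v y → WalkIn G (N G v) x y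
    neighbour-walk _ [ _ ] _ v~x _ = [ v~x ]
    neighbour-walk _ ((_ , e) ∷ [ _ ]) _ v~x v~y = (v~x , e) ∷ [ v~y ]
    neighbour-walk chordal w@(_ ∷ (_ ∷ rest)) (acc shorter) v~x v~y with hasInteriorNeighbour? w
    ... | yes (i , i<k , 0<i , v~wi) =
      neighbour-walk chordal (take w i) (shorter (≤-<-trans (length-take w i) i<k)) v~x v~wi
      ++ʷ neighbour-walk chordal (drop w i) (shorter drop-shorter) v~wi v~y
      where
      drop-shorter : length (drop w i) < length w
      drop-shorter = subst (_< length w) (≡-sym (length-drop w i)) (∸-monoʳ-< 0<i (<⇒≤ i<k))
    ... | no noInterior with hasShortcut? w
    ...   | yes shortcut =
      let (w' , w'<w) = shorten w shortcut in neighbour-walk chordal w' (shorter w'<w) v~x v~y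
    ...   | no noShortcut =
      ⊥-elim (chordal (length rest) _
        (apex-cycle v (shortcut-free-induced w noShortcut) (λ i _ → vertex-in w i)
                      (apex-of w v~x v~y noInterior)))

  -- In a connected chordal 2-connected graph, N(v) is non-empty (a walk from
  -- v to another vertex starts at a neighbour) and connected by neighbour-walk.
  two⇒locally-connected : Connected G → Chordal G → TwoConnected G → LocallyConnected G
  two⇒locally-connected connected chordal (_ , connected-v) v =
    first-edge (≢-sym u≢v) (proj₂ connected v u tt tt) ,
    λ x y v~x v~y → neighbour-walk v chordal (walk x y v~x v~y) (<-wellFounded _) v~x v~y
    where
    u : Fin n
    u = proj₁ (proj₁ (connected-v v))
    u≢v : u ≢ v
    u≢v = proj₂ (proj₁ (connected-v v))
    walk : ∀ x y → Adj G v x → Adj G v y → WalkIn G (_≢ v) x y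
    walk x y v~x v~y = proj₂ (connected-v v) x y (neighbour≢ v~x) (neighbour≢ v~y)

proposition3p1 : ∀ {n : ℕ} (G : Graph n) → Connected G → Chordal G →
    (TwoConnected G ⇔ LocallyConnected G)
proposition3p1 G connected chordal =
  mk⇔ (two⇒locally-connected G connected chordal) (locally⇒two-connected G connected)
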